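{- Let $E$ be a realizable matrix and let $(A,A+E)$ be a pair of Gram mates. Then for every $\mathbf x\in\mathrm{Row}(E)$ we have $A\mathbf x\in\mathrm{Col}(E)$, and for every $\mathbf y\in\mathrm{Col}(E)$ we have $A^T\mathbf y\in\mathrm{Row}(E)$.
   Context: Two $(0,1)$ matrices $A,B$ are Gram mates if $AA^T=BB^T$, $A^TA=B^TB$ and $A\ne B$. A $(0,1,-1)$ matrix $E$ with $E\mathbf 1=0$ and $\mathbf 1^TE=0^T$ is realizable if there is a pair of Gram mates $A$, $A+E$. $\mathrm{Row}(E)$, $\mathrm{Col}(E)$ denote the row space and column space of $E$, viewed as subspaces of column vectors.
   Formalization: The row space and column space of E are taken as spans over ℚ rather than ℝ, and the vectors x and y have rational entries. -}

module Defs where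

open import Data.Nat using (ℕ; zero; suc)
open import Data.Fin using (Fin; zero; suc)
open import Data.Rational using (ℚ; 0ℚ; 1ℚ; _+_; _*_; -_)
open import Data.Product using (Σ; _×_)
open import Data.Sum using (_⊎_)
open import Relation.Binary.PropositionalEquality using (_≡_)
open import Relation.Nullary using (¬_)

Matrix : ℕ → ℕ → Set
Matrix m n = Fin m → Fin n → ℚ

Vector : ℕ → Set
Vector n = Fin n → ℚ

∑ : (n : ℕ) → (Fin n → ℚ) → ℚ
∑ zero    f = 0ℚ
∑ (suc n) f = f zero + ∑ n (λ i → f (suc i))

transpose : ∀ {m n} → Matrix m n → Matrix n m
transpose A j i = A i j

_⊗_ : ∀ {m n p} → Matrix m n → Matrix n p → Matrix m p
_⊗_ {n = n} A B i k = ∑ n (λ j → A i j * B j k)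

_$$_ : ∀ {m n} → Matrix m n → Vector n → Vector m
_$$_ {n = n} A x i = ∑ n (λ j → A i j * x j)

_+ᴹ_ : ∀ {m n} → Matrix m n → Matrix m n → Matrix m n
(A +ᴹ B) i j = A i j + B i j

_≡ᴹ_ : ∀ {m n} → Matrix m n → Matrix m n → Set
A ≡ᴹ B = ∀ i j → A i j ≡ B i j

Is01 : ∀ {m n} → Matrix m n → Set
Is01 A = ∀ i j → (A i j ≡ 0ℚ) ⊎ (A i j ≡ 1ℚ)

Is01m1 : ∀ {m n} → Matrix m n → Set
Is01m1 E = ∀ i j → (E i j ≡ 0ℚ) ⊎ ((E i j ≡ 1ℚ) ⊎ (E i j ≡ - 1ℚ))

GramMates : ∀ {m n} → Matrix m n → Matrix m n → Set
GramMates A B =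
  Is01 A × Is01 B
  × ((A ⊗ transpose A) ≡ᴹ (B ⊗ transpose B))
  × ((transpose A ⊗ A) ≡ᴹ (transpose B ⊗ B))
  × ¬ (A ≡ᴹ B)

ZeroLineSums : ∀ {m n} → Matrix m n → Set
ZeroLineSums {m} {n} E =
  (∀ i → ∑ n (λ j → E i j) ≡ 0ℚ) × (∀ j → ∑ m (λ i → E i j) ≡ 0ℚ)

Realizable : ∀ {m n} → Matrix m n → Set
Realizable {m} {n} E =
  Is01m1 E × ZeroLineSums E × Σ (Matrix m n) (λ A → GramMates A (A +ᴹ E))

InRow : ∀ {m n} → Matrix m n → Vector n → Set
InRow {m} E x = Σ (Vector m) (λ z → ∀ j → x j ≡ (transpose E $$ z) j)

InCol : ∀ {m n} → Matrix m n → Vector m → Set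
InCol {m} {n} E y = Σ (Vector n) (λ w → ∀ i → y i ≡ (E $$ w) i)

-- Expanding (A + E)(A + E)ᵀ = AAᵀ gives AEᵀ = -E(A + E)ᵀ, hence A Eᵀ z = E ((A + E)ᵀ (-z)).
-- The transposed Gram identity AᵀA = (A + E)ᵀ(A + E) gives the dual inclusion in the same way;
-- the (0,1) entries and the zero line sums are never used.
module Submission where

open import Algebra.Bundles using (AbelianGroup; CommutativeMonoid)
open import Data.Nat using (ℕ; zero; suc)
open import Data.Fin using (Fin; zero; suc)
open import Data.Product using (_×_; _,_)
open import Data.Rational using (ℚ; 0ℚ; _+_; _*_; -_)
open import Data.Rational.Properties
  using (+-0-commutativeMonoid; +-0-abelianGroup; +-identityˡ; +-assoc; *-assoc; *-zeroˡ; *-zeroʳ;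
         *-distribˡ-+; *-distribʳ-+; neg-distribˡ-*; neg-distribʳ-*)
open import Relation.Binary.PropositionalEquality using (_≡_; refl; sym; trans; cong; cong₂; module ≡-Reasoning)

open import Algebra.Properties.CommutativeSemigroup (CommutativeMonoid.commutativeSemigroup +-0-commutativeMonoid)
  using (interchange)
open import Algebra.Properties.Group (AbelianGroup.group +-0-abelianGroup)
  using (identityʳ-unique; inverseˡ-unique)

open import Defs

open ≡-Reasoning

+-cancelˡ⇒≡-neg : ∀ a b c → a ≡ a + b + c → b ≡ - c
+-cancelˡ⇒≡-neg a b c a≡a+b+c =
  inverseˡ-unique b c (identityʳ-unique a (b + c) (trans (sym (+-assoc a b c)) (sym a≡a+b+c)))

∑-cong : ∀ n {f g : Fin n → ℚ} → (∀ i → f i ≡ g i) → ∑ n f ≡ ∑ n g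
∑-cong zero    f≗g = refl
∑-cong (suc n) f≗g = cong₂ _+_ (f≗g zero) (∑-cong n (λ i → f≗g (suc i)))

∑-zero : ∀ n → ∑ n (λ _ → 0ℚ) ≡ 0ℚ
∑-zero zero    = refl
∑-zero (suc n) = trans (+-identityˡ _) (∑-zero n)

∑-distrib-+ : ∀ n (f g : Fin n → ℚ) → ∑ n (λ i → f i + g i) ≡ ∑ n f + ∑ n g
∑-distrib-+ zero    f g = sym (+-identityˡ 0ℚ)
∑-distrib-+ (suc n) f g =
  trans (cong (f zero + g zero +_) (∑-distrib-+ n (λ i → f (suc i)) (λ i → g (suc i))))
        (interchange (f zero) (g zero) _ _)

∑-comm : ∀ m n (f : Fin m → Fin n → ℚ) → ∑ m (λ i → ∑ n (f i)) ≡ ∑ n (λ j → ∑ m (λ i → f i j))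
∑-comm zero    n f = sym (∑-zero n)
∑-comm (suc m) n f =
  trans (cong (∑ n (f zero) +_) (∑-comm m n (λ i → f (suc i)))) (sym (∑-distrib-+ n (f zero) _))

*-distribˡ-∑ : ∀ n x (f : Fin n → ℚ) → x * ∑ n f ≡ ∑ n (λ i → x * f i)
*-distribˡ-∑ zero    x f = *-zeroʳ x
*-distribˡ-∑ (suc n) x f =
  trans (*-distribˡ-+ x (f zero) _) (cong (x * f zero +_) (*-distribˡ-∑ n x (λ i → f (suc i))))

*-distribʳ-∑ : ∀ n x (f : Fin n → ℚ) → ∑ n f * x ≡ ∑ n (λ i → f i * x)
*-distribʳ-∑ zero    x f = *-zeroˡ x
*-distribʳ-∑ (suc n) x f =
  trans (*-distribʳ-+ x (f zero) _) (cong (f zero * x +_) (*-distribʳ-∑ n x (λ i → f (suc i))))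

-ᴹ_ : ∀ {m n} → Matrix m n → Matrix m n
(-ᴹ M) i j = - M i j

$$-congˡ : ∀ {m n} {M N : Matrix m n} → M ≡ᴹ N → ∀ v i → (M $$ v) i ≡ (N $$ v) i
$$-congˡ {n = n} M≡N v i = ∑-cong n (λ j → cong (_* v j) (M≡N i j))

$$-congʳ : ∀ {m n} (M : Matrix m n) {x y : Vector n} → (∀ j → x j ≡ y j) → ∀ i → (M $$ x) i ≡ (M $$ y) i
$$-congʳ {n = n} M x≗y i = ∑-cong n (λ j → cong (M i j *_) (x≗y j))

$$-neg : ∀ {m n} (M : Matrix m n) v i → (M $$ (λ j → - v j)) i ≡ ((-ᴹ M) $$ v) i
$$-neg {n = n} M v i =
  ∑-cong n (λ j → trans (sym (neg-distribʳ-* (M i j) (v j))) (neg-distribˡ-* (M i j) (v j)))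

$$-⊗ : ∀ {m n p} (M : Matrix m n) (N : Matrix n p) v i → (M $$ (N $$ v)) i ≡ ((M ⊗ N) $$ v) i
$$-⊗ {n = n} {p} M N v i = begin
  ∑ n (λ j → M i j * ∑ p (λ k → N j k * v k))    ≡⟨ ∑-cong n (λ j → *-distribˡ-∑ p (M i j) _) ⟩
  ∑ n (λ j → ∑ p (λ k → M i j * (N j k * v k)))  ≡⟨ ∑-comm n p _ ⟩
  ∑ p (λ k → ∑ n (λ j → M i j * (N j k * v k)))  ≡⟨ ∑-cong p (λ k → ∑-cong n (λ j →
                                                      sym (*-assoc (M i j) (N j k) (v k)))) ⟩
  ∑ p (λ k → ∑ n (λ j → M i j * N j k * v k))    ≡⟨ ∑-cong p (λ k → sym (*-distribʳ-∑ n (v k) _)) ⟩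
  ∑ p (λ k → (M ⊗ N) i k * v k)                  ∎

⊗-distribˡ-+ᴹ : ∀ {m n p} (M : Matrix m n) (N P : Matrix n p) → (M ⊗ (N +ᴹ P)) ≡ᴹ ((M ⊗ N) +ᴹ (M ⊗ P))
⊗-distribˡ-+ᴹ {n = n} M N P i k =
  trans (∑-cong n (λ j → *-distribˡ-+ (M i j) (N j k) (P j k))) (∑-distrib-+ n _ _)

⊗-distribʳ-+ᴹ : ∀ {m n p} (M N : Matrix m n) (P : Matrix n p) → ((M +ᴹ N) ⊗ P) ≡ᴹ ((M ⊗ P) +ᴹ (N ⊗ P))
⊗-distribʳ-+ᴹ {n = n} M N P i k =
  trans (∑-cong n (λ j → *-distribʳ-+ (P j k) (M i j) (N i j))) (∑-distrib-+ n _ _)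

gram⇒crossTerm : ∀ {m n} (A E : Matrix m n) →
  (A ⊗ transpose A) ≡ᴹ ((A +ᴹ E) ⊗ transpose (A +ᴹ E)) →
  (A ⊗ transpose E) ≡ᴹ (-ᴹ (E ⊗ transpose (A +ᴹ E)))
gram⇒crossTerm {m} {n} A E gram i k = +-cancelˡ⇒≡-neg _ _ _ (begin
  (A ⊗ Aᵀ) i k                                           ≡⟨ gram i k ⟩
  ((A +ᴹ E) ⊗ Bᵀ) i k                                    ≡⟨ ⊗-distribʳ-+ᴹ A E Bᵀ i k ⟩
  (A ⊗ Bᵀ) i k + (E ⊗ Bᵀ) i k                            ≡⟨ cong (_+ (E ⊗ Bᵀ) i k)
                                                              (⊗-distribˡ-+ᴹ A Aᵀ (transpose E) i k) ⟩
  (A ⊗ Aᵀ) i k + (A ⊗ transpose E) i k + (E ⊗ Bᵀ) i k   ∎)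
  where
  Aᵀ Bᵀ : Matrix n m
  Aᵀ = transpose A
  Bᵀ = transpose (A +ᴹ E)

gram⇒rowSpace↦colSpace : ∀ {m n} (A E : Matrix m n) →
  (A ⊗ transpose A) ≡ᴹ ((A +ᴹ E) ⊗ transpose (A +ᴹ E)) →
  (x : Vector n) → InRow E x → InCol E (A $$ x)
gram⇒rowSpace↦colSpace {m} {n} A E gram x (z , x≡Eᵀz) = Bᵀ $$ -z , λ i → begin
  (A $$ x) i                    ≡⟨ $$-congʳ A x≡Eᵀz i ⟩
  (A $$ (transpose E $$ z)) i   ≡⟨ $$-⊗ A (transpose E) z i ⟩
  ((A ⊗ transpose E) $$ z) i    ≡⟨ $$-congˡ (gram⇒crossTerm A E gram) z i ⟩
  ((-ᴹ (E ⊗ Bᵀ)) $$ z) i        ≡⟨ $$-neg (E ⊗ Bᵀ) z i ⟨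
  ((E ⊗ Bᵀ) $$ -z) i            ≡⟨ $$-⊗ E Bᵀ -z i ⟨
  (E $$ (Bᵀ $$ -z)) i           ∎
  where
  Bᵀ : Matrix n m
  Bᵀ = transpose (A +ᴹ E)
  -z : Vector m
  -z k = - z k

proposition3p3 : (m n : ℕ) (E A : Matrix m n) →
    Realizable E → GramMates A (A +ᴹ E) →
    ((x : Vector n) → InRow E x → InCol E (A $$ x))
    × ((y : Vector m) → InCol E y → InRow E (transpose A $$ y))
proposition3p3 m n E A _ (_ , _ , rowGram , colGram , _) =
  -- InRow (transpose E) and InCol (transpose E) unfold to InCol E and InRow E.
    gram⇒rowSpace↦colSpace A E rowGram
  , gram⇒rowSpace↦colSpace (transpose A) (transpose E) colGram
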